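{- Let $m,n\ge 2$ and let $C$ be any maximal configuration on the $m\times n$ grid. Then the number of occupied lots in the two southernmost rows, $|C\cap(\{m-1,m\}\times[n])|$, is at least $n+2$.
   Context: The $m\times n$ grid is $[m]\times[n]=\{(i,j):1\le i\le m,\ 1\le j\le n\}$; $(i,j)$ is the lot in row $i$ and column $j$, rows counted from the north (row $1$ is northernmost, row $m$ southernmost) and columns from the west. A configuration is a subset $C\subseteq[m]\times[n]$ (the occupied lots). A house at $(i,j)\in C$ is blocked from sunlight if $(i,j+1)$, $(i,j-1)$, $(i+1,j)$ all lie in the grid and are all occupied (lots outside the grid never obstruct sunlight). A configuration is permissible if no house in it is blocked; it is maximal if it is permissible and no permissible configuration strictly contains it. -}

module Defs where

open import Data.Nat using (ℕ; zero; suc; _+_; _∸_; _<_; _≤_)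
open import Data.Nat.Properties using (_<?_)
open import Data.Fin using (Fin; toℕ; fromℕ<)
open import Data.Bool using (Bool; true; false)
open import Data.Product using (_×_; Σ)
open import Data.List using (List; map; upTo)
open import Data.Nat.ListAction using (sum)
open import Relation.Nullary using (¬_; yes; no)
open import Relation.Binary.PropositionalEquality using (_≡_)

-- Rows/columns are 0-indexed: row 0 is the northernmost,
-- row m-1 the southernmost; column 0 is the westernmost.
Config : ℕ → ℕ → Set
Config m n = Fin m → Fin n → Bool

-- Occupancy at natural-number coordinates; lots outside the grid are
-- reported as unoccupied (they never obstruct sunlight).
occ : ∀ {m n} → Config m n → ℕ → ℕ → Bool
occ {m} {n} C i j with i <? m | j <? n
... | yes i<m | yes j<n = C (fromℕ< i<m) (fromℕ< j<n)
... | _ | _ = false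

Occ : ∀ {m n} → Config m n → ℕ → ℕ → Set
Occ C i j = occ C i j ≡ true

Blocked : ∀ {m n} → Config m n → Fin m → Fin n → Set
Blocked C i j =
  C i j ≡ true ×
  Occ C (toℕ i) (suc (toℕ j)) ×
  Σ ℕ (λ j′ → suc j′ ≡ toℕ j × Occ C (toℕ i) j′) ×
  Occ C (suc (toℕ i)) (toℕ j)

Permissible : ∀ {m n} → Config m n → Set
Permissible {m} {n} C = (i : Fin m) (j : Fin n) → ¬ Blocked C i j

_⊆C_ : ∀ {m n} → Config m n → Config m n → Set
_⊆C_ {m} {n} C D = (i : Fin m) (j : Fin n) → C i j ≡ true → D i j ≡ true

Maximal : ∀ {m n} → Config m n → Set
Maximal {m} {n} C =
  Permissible C ×
  ((D : Config m n) → Permissible D → C ⊆C D → D ⊆C C)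

b2n : Bool → ℕ
b2n true = 1
b2n false = 0

rowCount : ∀ {m n} → Config m n → ℕ → ℕ
rowCount {m} {n} C i = sum (map (λ j → b2n (occ C i j)) (upTo n))

southTwoCount : ∀ {m n} → Config m n → ℕ
southTwoCount {m} C = rowCount C (m ∸ 2) + rowCount C (m ∸ 1)

-- A maximal configuration admits no further house, so placing a house on an empty lot
-- must block some house: the new one or its west, east or north neighbour.  On the
-- southernmost row only the north neighbour can be blocked, hence every column meets the
-- two southern rows.  At the west end, either the first column is full in these rows, or
-- its northern lot is empty and placing a house there blocks its east neighbour, which
-- makes the second column full; symmetrically at the east end.  These two full columns
-- are distinct, which gives n + 2 houses.
module Submission where

open import Defs
open import Algebra.Properties.CommutativeSemigroup using (interchange)
open import Data.Bool using (true; false; _∨_; _∧_)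
open import Data.Bool.Properties using (∨-zeroʳ; T-∧; T-≡) renaming (_≟_ to _≟ᵇ_)
open import Data.Fin using (Fin; toℕ; fromℕ<)
open import Data.Fin.Properties using (toℕ<n; toℕ-fromℕ<; fromℕ<-toℕ)
open import Data.List using (List; []; _∷_; map; upTo; applyUpTo)
open import Data.List.Properties using (map-applyUpTo)
open import Data.Nat using (ℕ; zero; suc; _+_; _≤_; _<_; z≤n; s≤s; z<s; _≡ᵇ_)
open import Data.Nat.ListAction using (sum)
open import Data.Nat.Properties
  using (_<?_; ≤∧≢⇒<; ≡ᵇ⇒≡; ≡⇒≡ᵇ; 1+n≢n; m≢1+n+m; <-irrefl; ≤-refl; ≤-pred; n≤1+n; m≤n+m;
         +-mono-≤; +-comm; +-commutativeSemigroup)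
open import Data.Product using (Σ-syntax; _×_; _,_; proj₁; proj₂)
open import Data.Sum using (_⊎_; inj₁; inj₂; [_,_]′)
open import Function using (_∘_)
open import Function.Bundles using (Equivalence)
open import Relation.Nullary using (¬_; yes; no)
open import Relation.Nullary.Decidable using (decidable-stable)
open import Relation.Nullary.Negation using (¬¬-map; contradiction)
open import Relation.Binary.PropositionalEquality

open Equivalence using (to; from)

variable
  m n k n′ x y R K j p q : ℕ

Occ⇒lot : {C : Config m n} → Occ C x y → Σ[ a ∈ Fin m ] Σ[ b ∈ Fin n ] x ≡ toℕ a × y ≡ toℕ b × C a b ≡ true
Occ⇒lot {m} {n} {x = x} {y} o with x <? m | y <? n
... | yes x<m | yes y<n = fromℕ< x<m , fromℕ< y<n , sym (toℕ-fromℕ< x<m) , sym (toℕ-fromℕ< y<n) , o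
... | yes _   | no _    = contradiction o λ ()
... | no _    | _       = contradiction o λ ()

Occ⇒inGrid : {C : Config m n} → Occ C x y → x < m × y < n
Occ⇒inGrid {x = x} {y} {C = C} o with Occ⇒lot {x = x} {y} {C = C} o
... | a , b , refl , refl , _ = toℕ<n a , toℕ<n b

¬Occ-southOfGrid : (C : Config m n) (y : ℕ) → ¬ Occ C m y
¬Occ-southOfGrid {m} C y o = <-irrefl refl (proj₁ (Occ⇒inGrid {x = m} {y} {C = C} o))

¬Occ-eastOfGrid : (C : Config m n) (x : ℕ) → ¬ Occ C x n
¬Occ-eastOfGrid {n = n} C x o = <-irrefl refl (proj₂ (Occ⇒inGrid {x = x} {n} {C = C} o))

occ-toℕ : (C : Config m n) (a : Fin m) (b : Fin n) → occ C (toℕ a) (toℕ b) ≡ C a b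
occ-toℕ {m} {n} C a b with toℕ a <? m | toℕ b <? n
... | yes p | yes q = cong₂ C (fromℕ<-toℕ a p) (fromℕ<-toℕ b q)
... | yes _ | no q  = contradiction (toℕ<n b) q
... | no p  | _     = contradiction (toℕ<n a) p

Occ-stable : (C : Config m n) (x y : ℕ) → ¬ ¬ Occ C x y → Occ C x y
Occ-stable C x y = decidable-stable (occ C x y ≟ᵇ true)

data BlockedIn (P : ℕ → ℕ → Set) : ℕ → ℕ → Set where
  blocked : P x (suc y) → P x (suc (suc y)) → P x y → P (suc x) (suc y) → BlockedIn P x (suc y)

BlockedIn-map : {P Q : ℕ → ℕ → Set} → (∀ {x y} → P x y → Q x y) → BlockedIn P x y → BlockedIn Q x y
BlockedIn-map f (blocked c e w s) = blocked (f c) (f e) (f w) (f s)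

Blocked⇒BlockedIn : {C : Config m n} {a : Fin m} {b : Fin n} →
  Blocked C a b → BlockedIn (Occ C) (toℕ a) (toℕ b)
Blocked⇒BlockedIn {C = C} {a} {b} (Cab , e , (y , eq , w) , s) = blocked′ eq (trans (occ-toℕ C a b) Cab) e w s
  where
  blocked′ : ∀ {y′} → suc y ≡ y′ → Occ C (toℕ a) y′ → Occ C (toℕ a) (suc y′) → Occ C (toℕ a) y →
             Occ C (suc (toℕ a)) y′ → BlockedIn (Occ C) (toℕ a) y′
  blocked′ refl c e w s = blocked c e w s

Permissible⇒¬BlockedIn : {C : Config m n} → Permissible C → ¬ BlockedIn (Occ C) x y
Permissible⇒¬BlockedIn {C = C} perm (blocked {x} {y} c e w s) with Occ⇒lot {x = x} {suc y} {C = C} c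
... | a , b , refl , eq , Cab =
  perm a b (Cab , subst (λ t → Occ C x (suc t)) eq e , (y , eq , w) , subst (Occ C (suc x)) eq s)

insert : Config m n → ℕ → ℕ → Config m n
insert C R K a b = C a b ∨ ((toℕ a ≡ᵇ R) ∧ (toℕ b ≡ᵇ K))

⊆-insert : (C : Config m n) → C ⊆C insert C R K
⊆-insert C a b Cab rewrite Cab = refl

insert-lot : (C : Config m n) (R<m : R < m) (K<n : K < n) →
  insert C R K (fromℕ< R<m) (fromℕ< K<n) ≡ true
insert-lot {R = R} {K = K} C R<m K<n
  rewrite toℕ-fromℕ< R<m | toℕ-fromℕ< K<n
        | to T-≡ (≡⇒≡ᵇ R R refl) | to T-≡ (≡⇒≡ᵇ K K refl) = ∨-zeroʳ _

Occ⁺ : Config m n → ℕ → ℕ → ℕ → ℕ → Set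
Occ⁺ C R K x y = Occ C x y ⊎ (x ≡ R × y ≡ K)

Occ-insert : (C : Config m n) (R K : ℕ) {x y : ℕ} → Occ (insert C R K) x y → Occ⁺ C R K x y
Occ-insert C R K {x} {y} o with Occ⇒lot {x = x} {y} {C = insert C R K} o
... | a , b , refl , refl , Iab with C a b in Cab
...   | true  = inj₁ (trans (occ-toℕ C a b) Cab)
...   | false = inj₂ (≡ᵇ⇒≡ _ _ (proj₁ lot) , ≡ᵇ⇒≡ _ _ (proj₂ lot))
  where lot = to T-∧ (from T-≡ Iab)

Occ⁺⇒Occ : (C : Config m n) → Occ⁺ C R K x y → ¬ (x ≡ R × y ≡ K) → Occ C x y
Occ⁺⇒Occ C (inj₁ o)   _    = o
Occ⁺⇒Occ C (inj₂ new) ¬new = contradiction new ¬new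

-- InsertionBlocks C R K: the lots of C which, together with a new house at (R, K),
-- block the house named by the constructor.
data InsertionBlocks (C : Config m n) : ℕ → ℕ → Set where
  itself : Occ C x y → Occ C x (suc (suc y)) → Occ C (suc x) (suc y) →
           InsertionBlocks C x (suc y)
  west-neighbour : Occ C x y → Occ C x (suc y) → Occ C (suc x) (suc y) →
                   InsertionBlocks C x (suc (suc y))
  east-neighbour : Occ C x (suc y) → Occ C x (suc (suc y)) → Occ C (suc x) (suc y) →
                   InsertionBlocks C x y
  north-neighbour : Occ C x y → Occ C x (suc y) → Occ C x (suc (suc y)) →
                    InsertionBlocks C (suc x) (suc y)

BlockedIn-Occ⁺ : {C : Config m n} →
  BlockedIn (Occ⁺ C R K) x y → BlockedIn (Occ C) x y ⊎ InsertionBlocks C R K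
BlockedIn-Occ⁺ {C = C} (blocked (inj₂ (refl , refl)) e w s) =
  inj₂ (itself (Occ⁺⇒Occ C w λ (_ , eq) → 1+n≢n (sym eq))
               (Occ⁺⇒Occ C e λ (_ , eq) → 1+n≢n eq)
               (Occ⁺⇒Occ C s λ (eq , _) → 1+n≢n eq))
BlockedIn-Occ⁺ {C = C} (blocked {y = y} (inj₁ c) (inj₂ (refl , refl)) w s) =
  inj₂ (west-neighbour (Occ⁺⇒Occ C w λ (_ , eq) → m≢1+n+m y eq) c
                       (Occ⁺⇒Occ C s λ (eq , _) → 1+n≢n eq))
BlockedIn-Occ⁺ {C = C} (blocked (inj₁ c) (inj₁ e) (inj₂ (refl , refl)) s) =
  inj₂ (east-neighbour c e (Occ⁺⇒Occ C s λ (eq , _) → 1+n≢n eq))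
BlockedIn-Occ⁺ (blocked (inj₁ c) (inj₁ e) (inj₁ w) (inj₂ (refl , refl))) =
  inj₂ (north-neighbour w c e)
BlockedIn-Occ⁺ (blocked (inj₁ c) (inj₁ e) (inj₁ w) (inj₁ s)) = inj₁ (blocked c e w s)

maximal⇒insertionBlocks : {C : Config m n} → Maximal C → R < m → K < n → occ C R K ≡ false →
  ¬ ¬ InsertionBlocks C R K
maximal⇒insertionBlocks {R = R} {K} {C = C} (perm , maximal) R<m K<n empty ¬blocks =
  contradiction (trans (sym empty) occupied) λ ()
  where
  permissible : Permissible (insert C R K)
  permissible a b blocked-ab =
    [ Permissible⇒¬BlockedIn perm , ¬blocks ]′
      (BlockedIn-Occ⁺ (BlockedIn-map (Occ-insert C R K)
        (Blocked⇒BlockedIn {C = insert C R K} {a} {b} blocked-ab)))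

  occupied : occ C R K ≡ true
  occupied =
    subst₂ (λ x y → occ C x y ≡ true) (toℕ-fromℕ< R<m) (toℕ-fromℕ< K<n)
      (trans (occ-toℕ C _ _) (maximal (insert C R K) permissible (⊆-insert C) _ _ (insert-lot C R<m K<n)))

insertionBlocks-westEdge : {C : Config m n} → InsertionBlocks C R 0 →
  Occ C R 1 × Occ C R 2 × Occ C (suc R) 1
insertionBlocks-westEdge (east-neighbour e e′ s) = e , e′ , s

insertionBlocks-eastEdge : {C : Config m (suc (suc n′))} → InsertionBlocks C R (suc n′) →
  0 < n′ × Occ C R n′ × Occ C (suc R) n′
insertionBlocks-eastEdge {R = R} {C = C} (itself _ e _)              = contradiction e (¬Occ-eastOfGrid C R)
insertionBlocks-eastEdge                 (west-neighbour _ c s)      = z<s , c , s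
insertionBlocks-eastEdge {R = R} {C = C} (east-neighbour e _ _)      = contradiction e (¬Occ-eastOfGrid C R)
insertionBlocks-eastEdge         {C = C} (north-neighbour {x} _ _ e) = contradiction e (¬Occ-eastOfGrid C x)

insertionBlocks-southEdge : {C : Config (suc (suc k)) n} → InsertionBlocks C (suc k) K →
  (Σ[ y ∈ ℕ ] K ≡ suc y) × Occ C k K × Occ C k (suc K)
insertionBlocks-southEdge {C = C} (itself {y = y} _ _ s)          = contradiction s (¬Occ-southOfGrid C (suc y))
insertionBlocks-southEdge {C = C} (west-neighbour {y = y} _ _ s)  = contradiction s (¬Occ-southOfGrid C (suc y))
insertionBlocks-southEdge {C = C} (east-neighbour {y = y} _ _ s)  = contradiction s (¬Occ-southOfGrid C (suc y))
insertionBlocks-southEdge         (north-neighbour {y = y} _ c e) = (y , refl) , c , e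

sum-map-+ : (f g : ℕ → ℕ) (js : List ℕ) →
  sum (map f js) + sum (map g js) ≡ sum (map (λ j → f j + g j) js)
sum-map-+ f g []       = refl
sum-map-+ f g (j ∷ js) =
  trans (interchange +-commutativeSemigroup (f j) _ (g j) _) (cong (f j + g j +_) (sum-map-+ f g js))

n≤sum-applyUpTo : ∀ n {f : ℕ → ℕ} → (∀ {j} → j < n → 1 ≤ f j) → n ≤ sum (applyUpTo f n)
n≤sum-applyUpTo zero    pos = z≤n
n≤sum-applyUpTo (suc n) pos = +-mono-≤ (pos z<s) (n≤sum-applyUpTo n (pos ∘ s≤s))

1+n≤sum-applyUpTo : ∀ n {f : ℕ → ℕ} → (∀ {j} → j < n → 1 ≤ f j) →
  ∀ {p} → p < n → 2 ≤ f p → suc n ≤ sum (applyUpTo f n)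
1+n≤sum-applyUpTo (suc n) pos {zero}  _         2≤fp =
  +-mono-≤ 2≤fp (n≤sum-applyUpTo n (pos ∘ s≤s))
1+n≤sum-applyUpTo (suc n) pos {suc p} (s≤s p<n) 2≤fp =
  +-mono-≤ (pos z<s) (1+n≤sum-applyUpTo n (pos ∘ s≤s) p<n 2≤fp)

2+n≤sum-applyUpTo : ∀ n {f : ℕ → ℕ} → (∀ {j} → j < n → 1 ≤ f j) →
  ∀ {p q} → p < q → q < n → 2 ≤ f p → 2 ≤ f q → suc (suc n) ≤ sum (applyUpTo f n)
2+n≤sum-applyUpTo (suc n) pos {zero}  (s≤s z≤n) (s≤s q<n) 2≤fp 2≤fq =
  +-mono-≤ 2≤fp (1+n≤sum-applyUpTo n (pos ∘ s≤s) q<n 2≤fq)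
2+n≤sum-applyUpTo (suc n) pos {suc p} (s≤s p<q) (s≤s q<n) 2≤fp 2≤fq =
  +-mono-≤ (pos z<s) (2+n≤sum-applyUpTo n (pos ∘ s≤s) p<q q<n 2≤fp 2≤fq)

columnCount : Config m n → ℕ → ℕ → ℕ
columnCount C x j = b2n (occ C x j) + b2n (occ C (suc x) j)

rowCount-+ : (C : Config m n) (x : ℕ) →
  rowCount C x + rowCount C (suc x) ≡ sum (applyUpTo (columnCount C x) n)
rowCount-+ {n = n} C x =
  trans (sum-map-+ _ _ (upTo n)) (cong sum (map-applyUpTo (λ j → j) (columnCount C x) n))

FullColumn : Config m n → ℕ → ℕ → Set
FullColumn C x j = Occ C x j × Occ C (suc x) j

FullColumn⇒2≤columnCount : (C : Config m n) → FullColumn C x j → 2 ≤ columnCount C x j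
FullColumn⇒2≤columnCount {x = x} {j} C (upper , lower) rewrite upper | lower = ≤-refl

two-fullColumns⇒n+2≤rowCount : (C : Config m n) → (∀ {j} → j < n → 1 ≤ columnCount C x j) →
  p < q → q < n → FullColumn C x p → FullColumn C x q → n + 2 ≤ rowCount C x + rowCount C (suc x)
two-fullColumns⇒n+2≤rowCount {n = n} {x = x} C pos p<q q<n full-p full-q =
  subst₂ _≤_ (+-comm 2 n) (sym (rowCount-+ C x))
    (2+n≤sum-applyUpTo n pos p<q q<n (FullColumn⇒2≤columnCount C full-p) (FullColumn⇒2≤columnCount C full-q))

module SouthernRows {k n′ : ℕ} {C : Config (suc (suc k)) (suc (suc n′))} (maximal : Maximal C) where

  k<m : k < suc (suc k)
  k<m = s≤s (n≤1+n k)

  emptySouthLot⇒occupiedNorth : j < suc (suc n′) → occ C (suc k) j ≡ false →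
    ¬ ¬ ((Σ[ y ∈ ℕ ] j ≡ suc y) × Occ C k j × Occ C k (suc j))
  emptySouthLot⇒occupiedNorth j<n empty =
    ¬¬-map insertionBlocks-southEdge (maximal⇒insertionBlocks maximal ≤-refl j<n empty)

  columnCount-pos : j < suc (suc n′) → 1 ≤ columnCount C k j
  columnCount-pos {j} j<n with occ C (suc k) j in south
  ... | true  = m≤n+m 1 _
  ... | false rewrite Occ-stable C k j (¬¬-map (proj₁ ∘ proj₂) (emptySouthLot⇒occupiedNorth j<n south)) =
    ≤-refl

  southWestCorner : Occ C (suc k) 0
  southWestCorner with occ C (suc k) 0 in south
  ... | true  = refl
  ... | false = contradiction (λ { ((_ , ()) , _) }) (emptySouthLot⇒occupiedNorth z<s south)

  southEastCorner : Occ C (suc k) (suc n′)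
  southEastCorner with occ C (suc k) (suc n′) in south
  ... | true  = refl
  ... | false =
    contradiction (λ (_ , _ , e) → ¬Occ-eastOfGrid C k e) (emptySouthLot⇒occupiedNorth ≤-refl south)

  westFullColumn : FullColumn C k 0 ⊎ (FullColumn C k 1 × Occ C k 2)
  westFullColumn with occ C k 0 in north
  ... | true  = inj₁ (refl , southWestCorner)
  ... | false = inj₂ ((Occ-stable C k 1 (¬¬-map proj₁ edge) ,
                       Occ-stable C (suc k) 1 (¬¬-map (proj₂ ∘ proj₂) edge)) ,
                      Occ-stable C k 2 (¬¬-map (proj₁ ∘ proj₂) edge))
    where
    edge : ¬ ¬ (Occ C k 1 × Occ C k 2 × Occ C (suc k) 1)
    edge = ¬¬-map insertionBlocks-westEdge (maximal⇒insertionBlocks maximal k<m z<s north)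

  eastFullColumn : FullColumn C k (suc n′) ⊎ (occ C k (suc n′) ≡ false × 0 < n′ × FullColumn C k n′)
  eastFullColumn with occ C k (suc n′) in north
  ... | true  = inj₁ (refl , southEastCorner)
  ... | false = inj₂ (refl , decidable-stable (0 <? n′) (¬¬-map proj₁ edge) ,
                      (Occ-stable C k n′ (¬¬-map (proj₁ ∘ proj₂) edge) ,
                       Occ-stable C (suc k) n′ (¬¬-map (proj₂ ∘ proj₂) edge)))
    where
    edge : ¬ ¬ (0 < n′ × Occ C k n′ × Occ C (suc k) n′)
    edge = ¬¬-map insertionBlocks-eastEdge (maximal⇒insertionBlocks maximal k<m ≤-refl north)

  n+2≤southTwoCount : suc (suc n′) + 2 ≤ southTwoCount C
  n+2≤southTwoCount = combine westFullColumn eastFullColumn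
    where
    bound : p < q → q < suc (suc n′) → FullColumn C k p → FullColumn C k q →
            suc (suc n′) + 2 ≤ southTwoCount C
    bound = two-fullColumns⇒n+2≤rowCount {x = k} C columnCount-pos

    n′<n : n′ < suc (suc n′)
    n′<n = s≤s (n≤1+n n′)

    combine : FullColumn C k 0 ⊎ (FullColumn C k 1 × Occ C k 2) →
              FullColumn C k (suc n′) ⊎ (occ C k (suc n′) ≡ false × 0 < n′ × FullColumn C k n′) →
              suc (suc n′) + 2 ≤ southTwoCount C
    combine (inj₁ west)        (inj₁ east)                  = bound z<s ≤-refl west east
    combine (inj₁ west)        (inj₂ (_ , 0<n′ , east))     = bound 0<n′ n′<n west east
    combine (inj₂ (west , u₂)) (inj₁ east)                  =
      bound (≤-pred (proj₂ (Occ⇒inGrid {x = k} {2} {C = C} u₂))) ≤-refl west east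
    combine (inj₂ (west , u₂)) (inj₂ (empty , 0<n′ , east)) = bound 1<n′ n′<n west east
      where
      1<n′ : 1 < n′
      1<n′ = ≤∧≢⇒< 0<n′ λ 1≡n′ →
        contradiction (trans (sym empty) (subst (λ t → occ C k (suc t) ≡ true) 1≡n′ u₂)) λ ()

lemma4p1 : (m n : ℕ) → 2 ≤ m → 2 ≤ n → (C : Config m n) → Maximal C →
    n + 2 ≤ southTwoCount C
lemma4p1 (suc (suc k)) (suc (suc n′)) _ _ C maximal = SouthernRows.n+2≤southTwoCount maximal
lemma4p1 (suc zero)    _         (s≤s ()) _        _ _
lemma4p1 (suc (suc _)) (suc zero) _        (s≤s ()) _ _
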